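{- Let $f(x)=\sum_{n\geq 1}|I(321)_n|x^n$, $\varepsilon(x)=\sum_{m\geq 1}|I(321)_{2m}|x^{2m}$ and $\omega(x)=\sum_{m\geq 0}|I(321)_{2m+1}|x^{2m+1}$. Then $$\varepsilon+\omega=f,\qquad \varepsilon=2x\,\omega.$$
   Context: A permutation of length $n$ is a bijection of $\{1,\dots,n\}$. A permutation avoids $321$ if it has no indices $i<j<k$ with $\pi(i)>\pi(j)>\pi(k)$. An involution satisfies $\pi(\pi(i))=i$ for all $i$. $I(321)_n$ is the set of involutions of length $n$ avoiding $321$. -}

module Defs where

open import Data.Nat using (ℕ; zero; suc; _+_; _*_)
open import Data.Nat.Properties using () renaming (_≟_ to _≟ℕ_)
open import Data.Fin using (Fin; _<_; _<?_; _≟_)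
open import Data.Fin.Properties using (all?; any?)
open import Data.Vec using (Vec; []; _∷_; lookup)
open import Data.List using (List; [_]; concatMap; map; allFin; filter; length)
open import Data.Product using (_×_; ∃)
open import Data.Bool using (if_then_else_)
open import Relation.Nullary using (¬_; Dec)
open import Relation.Nullary.Decidable using (_×-dec_; _→-dec_; ¬?; does)
open import Relation.Binary.PropositionalEquality using (_≡_)
open import Data.Nat.Base using (_%_; _≤ᵇ_)

-- A map {1..n} → {1..n} (indices shifted to Fin n = {0..n-1}) represented by
-- its table of values.
Map : ℕ → Set
Map n = Vec (Fin n) n

IsBijection : ∀ {n} → Map n → Set
IsBijection {n} π =
  (∀ i j → lookup π i ≡ lookup π j → i ≡ j) × (∀ j → ∃ λ i → lookup π i ≡ j)

IsInvolution : ∀ {n} → Map n → Set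
IsInvolution {n} π = ∀ i → lookup π (lookup π i) ≡ i

Avoids321 : ∀ {n} → Map n → Set
Avoids321 {n} π = ∀ i j k → i < j → j < k →
  ¬ (lookup π j < lookup π i × lookup π k < lookup π j)

IsI321 : ∀ {n} → Map n → Set
IsI321 π = IsBijection π × IsInvolution π × Avoids321 π

isBijection? : ∀ {n} (π : Map n) → Dec (IsBijection π)
isBijection? π =
  all? (λ i → all? (λ j → (lookup π i ≟ lookup π j) →-dec (i ≟ j)))
  ×-dec all? (λ j → any? (λ i → lookup π i ≟ j))

isInvolution? : ∀ {n} (π : Map n) → Dec (IsInvolution π)
isInvolution? π = all? (λ i → lookup π (lookup π i) ≟ i)

avoids321? : ∀ {n} (π : Map n) → Dec (Avoids321 π)
avoids321? π = all? λ i → all? λ j → all? λ k →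
  (i <? j) →-dec (j <? k) →-dec
  ¬? ((lookup π j <? lookup π i) ×-dec (lookup π k <? lookup π j))

isI321? : ∀ {n} (π : Map n) → Dec (IsI321 π)
isI321? π = isBijection? π ×-dec isInvolution? π ×-dec avoids321? π

allVecs : (n k : ℕ) → List (Vec (Fin n) k)
allVecs n zero = [ [] ]
allVecs n (suc k) = concatMap (λ a → map (a ∷_) (allVecs n k)) (allFin n)

I321count : ℕ → ℕ
I321count n = length (filter isI321? (allVecs n n))

Series : Set
Series = ℕ → ℕ

fSeries : Series
fSeries zero = 0
fSeries (suc n) = I321count (suc n)

εSeries : Series
εSeries zero = 0
εSeries (suc n) = if does ((suc n % 2) ≟ℕ 0) then I321count (suc n) else 0

ωSeries : Series
ωSeries n = if does ((n % 2) ≟ℕ 1) then I321count n else 0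

_⊕_ : Series → Series → Series
(a ⊕ b) n = a n + b n

x·_ : Series → Series
(x· a) zero = 0
(x· a) (suc n) = a n

_·ₛ_ : ℕ → Series → Series
(c ·ₛ a) n = c * a n

module Submission where

-- Encode an involution π by the word whose i-th letter is U, D or F
-- according as π(i) > i, π(i) < i or π(i) = i.  For 321-avoiding π the arcs
-- i ↦ π(i) do not nest and no arc passes over a fixed point, so the word is a
-- path: it never drops below 0, has flats only at height 0, and returns to 0.
-- Conversely every such path is decoded by matching the k-th up step with
-- the k-th down step.  Hence |I(321)_n| is the number of such paths.  These
-- paths satisfy the recurrences of a height-indexed count, from which one
-- shows by induction that starting one level higher does not change the
-- count when length + height is odd; in particular the count doubles from
-- odd n to n+1.  The file develops, in order: paths and their counts, ranks
-- of letters in words, the encoding and decoding maps, injectivity of the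
-- encoding on I(321)_n, the fact that encodings are paths, the resulting
-- equality of counts, and finally the series identities.

open import Defs
open import Data.Nat using (ℕ; zero; suc; _+_; _*_; _%_; _≤_; _<_; z≤n; s≤s; s≤s⁻¹)
open import Data.Nat.Properties
  using ( +-suc; +-comm; +-identityʳ; ≤-pred; +-monoʳ-≤; +-monoʳ-<; <-cmp; <⇒≢; m≤m+n; m<m+n; n≢0⇒n>0
        ; <-asym; <-irrefl; <-trans; <⇒≤; ≤⇒≯; ≤-trans; ≤-reflexive; <⇒≱; ≤∧≢⇒<; m≤n⇒m<n∨m≡n
        ; m<n⇒m<1+n; n<1+n; _≟_; _<?_; _≤?_ )
open import Data.Nat.DivMod using ([m+n]%n≡m%n)
open import Data.Fin using (Fin; toℕ) renaming (zero to fz; suc to fs)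
open import Data.Fin.Properties using (toℕ-injective; toℕ<n; any?; suc-injective)
open import Data.Bool using (if_then_else_)
open import Data.Empty using (⊥)
open import Data.Product using (_×_; _,_; proj₁; proj₂; ∃)
open import Data.Sum using (_⊎_; inj₁; inj₂)
open import Data.Vec using (Vec; []; _∷_; lookup; tabulate)
open import Data.Vec.Properties using (lookup∘tabulate; tabulate-cong; tabulate∘lookup; ∷-injectiveˡ; ∷-injectiveʳ)
open import Data.List using (List; [_]; []; map; _++_; length; filter; allFin)
open import Data.List.Properties using (length-map; length-++)
open import Data.List.Membership.Propositional using (_∈_)
open import Data.List.Membership.Propositional.Properties
  using (∈-map⁺; ∈-map⁻; ∈-++⁺ˡ; ∈-++⁺ʳ; ∈-++⁻; ∈-concatMap⁺; ∈-allFin; ∈-filter⁺; ∈-filter⁻)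
open import Data.List.Membership.Propositional.Properties.WithK using (unique∧set⇒bag)
open import Data.List.Relation.Unary.Unique.Propositional using (Unique)
import Data.List.Relation.Unary.Unique.Propositional.Properties as UP
import Data.List.Relation.Unary.AllPairs as AP
import Data.List.Relation.Unary.AllPairs.Properties as APP
import Data.List.Relation.Unary.All as All
import Data.List.Relation.Unary.All.Properties as AllP
import Data.List.Relation.Unary.Any as Any
open import Data.List.Relation.Unary.Any using (here; there)
open import Data.List.Relation.Binary.Disjoint.Propositional using (Disjoint)
open import Data.List.Relation.Binary.BagAndSetEquality using (∼bag⇒↭)
open import Data.List.Relation.Binary.Permutation.Propositional.Properties using (↭-length)
open import Function using (_∘_)
open import Function.Bundles using (_⇔_; mk⇔)
open import Relation.Nullary using (¬_; Dec; yes; no; does; contradiction)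
open import Relation.Nullary.Decidable using (_×-dec_)
open import Relation.Binary using (Tri; tri<; tri≈; tri>)
open import Relation.Binary.PropositionalEquality
  using (_≡_; _≢_; refl; sym; trans; cong; cong₂; subst; subst₂; module ≡-Reasoning)

data Letter : Set where
  F U D : Letter

Path : ∀ {n} → ℕ → Vec Letter n → Set
Path h [] = h ≡ 0
Path h (F ∷ w) = h ≡ 0 × Path 0 w
Path h (U ∷ w) = Path (suc h) w
Path zero (D ∷ w) = ⊥
Path (suc h) (D ∷ w) = Path h w

paths : ℕ → (n : ℕ) → List (Vec Letter n)
paths zero zero = [ [] ]
paths (suc h) zero = []
paths zero (suc n) = map (F ∷_) (paths 0 n) ++ map (U ∷_) (paths 1 n)
paths (suc h) (suc n) = map (U ∷_) (paths (suc (suc h)) n) ++ map (D ∷_) (paths h n)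

pathCount : ℕ → ℕ → ℕ
pathCount h n = length (paths h n)

length-map-++ : ∀ {A B C : Set} (f : A → C) (g : B → C) xs ys →
                length (map f xs ++ map g ys) ≡ length xs + length ys
length-map-++ f g xs ys =
  trans (length-++ (map f xs)) (cong₂ _+_ (length-map f xs) (length-map g ys))

pathCount-ground : ∀ n → pathCount 0 (suc n) ≡ pathCount 0 n + pathCount 1 n
pathCount-ground n = length-map-++ (F ∷_) (U ∷_) (paths 0 n) (paths 1 n)

pathCount-raised : ∀ h n → pathCount (suc h) (suc n) ≡ pathCount (suc (suc h)) n + pathCount h n
pathCount-raised h n = length-map-++ (U ∷_) (D ∷_) (paths (suc (suc h)) n) (paths h n)

-- Parity as inductive predicates, so that induction can follow it.
data Even : ℕ → Set
data Odd : ℕ → Set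

data Even where
  even-zero : Even 0
  even-suc : ∀ {n} → Odd n → Even (suc n)

data Odd where
  odd-suc : ∀ {n} → Even n → Odd (suc n)

even-shift : ∀ n h → Even (n + h) → Odd (n + suc h)
even-shift n h e = subst Odd (sym (+-suc n h)) (odd-suc e)

even-unshift : ∀ n h → Even (n + suc h) → Odd (n + h)
even-unshift n h e with subst Even (+-suc n h) e
... | even-suc o = o

-- By induction on n via the recurrences; both parity hypotheses needed
-- in the step hold because n - 1 + (h ± 1) is again odd.
pathCount-shift : ∀ n h → Odd (n + h) → pathCount h n ≡ pathCount (suc h) n
pathCount-shift zero (suc h) _ = refl
pathCount-shift (suc n) zero (odd-suc e) = begin
  pathCount 0 (suc n)            ≡⟨ pathCount-ground n ⟩
  pathCount 0 n + pathCount 1 n  ≡⟨ cong (pathCount 0 n +_) (pathCount-shift n 1 (even-shift n 0 e)) ⟩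
  pathCount 0 n + pathCount 2 n  ≡⟨ +-comm (pathCount 0 n) (pathCount 2 n) ⟩
  pathCount 2 n + pathCount 0 n  ≡⟨ sym (pathCount-raised 0 n) ⟩
  pathCount 1 (suc n)            ∎
  where open ≡-Reasoning
pathCount-shift (suc n) (suc k) (odd-suc e) = begin
  pathCount (suc k) (suc n)                           ≡⟨ pathCount-raised k n ⟩
  pathCount (suc (suc k)) n + pathCount k n           ≡⟨ cong₂ _+_ (pathCount-shift n (suc (suc k)) (even-shift n (suc k) e))
                                                                   (pathCount-shift n k (even-unshift n k e)) ⟩
  pathCount (suc (suc (suc k))) n + pathCount (suc k) n ≡⟨ sym (pathCount-raised (suc k) n) ⟩
  pathCount (suc (suc k)) (suc n)                     ∎
  where open ≡-Reasoning

pathCount-double : ∀ n → Odd n → pathCount 0 (suc n) ≡ 2 * pathCount 0 n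
pathCount-double n o = begin
  pathCount 0 (suc n)                  ≡⟨ pathCount-ground n ⟩
  pathCount 0 n + pathCount 1 n        ≡⟨ cong (pathCount 0 n +_) (sym (pathCount-shift n 0 (subst Odd (sym (+-identityʳ n)) o))) ⟩
  pathCount 0 n + pathCount 0 n        ≡⟨ cong (pathCount 0 n +_) (sym (+-identityʳ (pathCount 0 n))) ⟩
  2 * pathCount 0 n                    ∎
  where open ≡-Reasoning

_≟L_ : (x y : Letter) → Dec (x ≡ y)
F ≟L F = yes refl
F ≟L U = no (λ ())
F ≟L D = no (λ ())
U ≟L F = no (λ ())
U ≟L U = yes refl
U ≟L D = no (λ ())
D ≟L F = no (λ ())
D ≟L U = no (λ ())
D ≟L D = yes refl

ind : Letter → Letter → ℕ
ind L x = if does (x ≟L L) then 1 else 0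

ind-match : ∀ {L x} → x ≡ L → ind L x ≡ 1
ind-match {L} {x} e with x ≟L L
... | yes _ = refl
... | no ne = contradiction e ne

ind-miss : ∀ {L x} → x ≢ L → ind L x ≡ 0
ind-miss {L} {x} ne with x ≟L L
... | yes e = contradiction e ne
... | no _ = refl

rank : ∀ {n} → Letter → Vec Letter n → Fin n → ℕ
rank L (x ∷ w) fz = 0
rank L (x ∷ w) (fs i) = ind L x + rank L w i

total : ∀ {n} → Letter → Vec Letter n → ℕ
total L [] = 0
total L (x ∷ w) = ind L x + total L w

rank-mono : ∀ {n} L (w : Vec Letter n) {i j} → toℕ j ≤ toℕ i → rank L w j ≤ rank L w i
rank-mono L (x ∷ w) {i} {fz} _ = z≤n
rank-mono L (x ∷ w) {fs i} {fs j} (s≤s le) = +-monoʳ-≤ (ind L x) (rank-mono L w le)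

rank-strict : ∀ {n} L (w : Vec Letter n) {i j} → lookup w j ≡ L → toℕ j < toℕ i → rank L w j < rank L w i
rank-strict L (x ∷ w) {fs i} {fz} e _ rewrite ind-match {L} {x} e = s≤s z≤n
rank-strict L (x ∷ w) {fs i} {fs j} e (s≤s lt) = +-monoʳ-< (ind L x) (rank-strict L w e lt)

rank<total : ∀ {n} L (w : Vec Letter n) i → lookup w i ≡ L → rank L w i < total L w
rank<total L (x ∷ w) fz e rewrite ind-match {L} {x} e = s≤s z≤n
rank<total L (x ∷ w) (fs i) e = +-monoʳ-< (ind L x) (rank<total L w i e)

rank-attained : ∀ {n} L (w : Vec Letter n) r → r < total L w → ∃ λ j → lookup w j ≡ L × rank L w j ≡ r
rank-attained L (x ∷ w) r lt with x ≟L L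
rank-attained L (x ∷ w) zero lt | yes e = fz , e , refl
rank-attained L (x ∷ w) (suc r) lt | yes e with rank-attained L w r (≤-pred lt)
... | j , e′ , c = fs j , e′ , trans (cong (_+ rank L w j) (ind-match e)) (cong suc c)
rank-attained L (x ∷ w) r lt | no ne with rank-attained L w r lt
... | j , e′ , c = fs j , e′ , trans (cong (_+ rank L w j) (ind-miss ne)) c

rank-injective : ∀ {n} L (w : Vec Letter n) {i j} → lookup w i ≡ L → lookup w j ≡ L →
                 rank L w i ≡ rank L w j → i ≡ j
rank-injective L w {i} {j} ei ej c with <-cmp (toℕ i) (toℕ j)
... | tri< lt _ _ = contradiction c (<⇒≢ (rank-strict L w ei lt))
... | tri≈ _ eq _ = toℕ-injective eq
... | tri> _ _ gt = contradiction (sym c) (<⇒≢ (rank-strict L w ej gt))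

record PrefixHeight {n} (h : ℕ) (w : Vec Letter n) (i : Fin n) : Set where
  field
    height : ℕ
    balance : rank D w i + height ≡ h + rank U w i
    flat-ground : lookup w i ≡ F → height ≡ 0
    down-positive : lookup w i ≡ D → height ≢ 0

extend : ∀ {n h h′ x} {w : Vec Letter n} {i} (r : PrefixHeight h′ w i) →
         rank D (x ∷ w) (fs i) + PrefixHeight.height r ≡ h + rank U (x ∷ w) (fs i) →
         PrefixHeight h (x ∷ w) (fs i)
extend r b = record { height = height ; balance = b ; flat-ground = flat-ground ; down-positive = down-positive }
  where open PrefixHeight r

prefixHeight : ∀ {n} h (w : Vec Letter n) → Path h w → ∀ i → PrefixHeight h w i
prefixHeight h (x ∷ w) p fz = record
  { height = h ; balance = sym (+-identityʳ h) ; flat-ground = flat x p ; down-positive = down x h p }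
  where
  flat : ∀ x → Path h (x ∷ w) → x ≡ F → h ≡ 0
  flat F (h≡0 , _) _ = h≡0
  down : ∀ x h → Path h (x ∷ w) → x ≡ D → h ≢ 0
  down D zero () _
  down D (suc h) _ _ ()
prefixHeight h (F ∷ w) (refl , p) (fs i) = extend (prefixHeight 0 w p i) balance
  where open PrefixHeight (prefixHeight 0 w p i)
prefixHeight h (U ∷ w) p (fs i) = extend (prefixHeight (suc h) w p i) (trans balance (sym (+-suc h _)))
  where open PrefixHeight (prefixHeight (suc h) w p i)
prefixHeight (suc h) (D ∷ w) p (fs i) = extend (prefixHeight h w p i) (cong suc balance)
  where open PrefixHeight (prefixHeight h w p i)

module _ {n} (w : Vec Letter n) (p : Path 0 w) (i : Fin n) where
  open PrefixHeight (prefixHeight 0 w p i)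

  downs≤ups : rank D w i ≤ rank U w i
  downs≤ups = subst (rank D w i ≤_) balance (m≤m+n (rank D w i) height)

  downs<ups : lookup w i ≡ D → rank D w i < rank U w i
  downs<ups e = subst (rank D w i <_) balance (m<m+n (rank D w i) (n≢0⇒n>0 (down-positive e)))

  downs≡ups : lookup w i ≡ F → rank D w i ≡ rank U w i
  downs≡ups e = trans (sym (trans (cong (rank D w i +_) (flat-ground e)) (+-identityʳ _))) balance

path-balance : ∀ {n} h (w : Vec Letter n) → Path h w → total D w ≡ h + total U w
path-balance h [] refl = refl
path-balance h (F ∷ w) (refl , p) = path-balance 0 w p
path-balance h (U ∷ w) p = trans (path-balance (suc h) w p) (sym (+-suc h _))
path-balance (suc h) (D ∷ w) p = cong suc (path-balance h w p)

letterOf : ∀ {n} → Fin n → Fin n → Letter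
letterOf i v with <-cmp (toℕ v) (toℕ i)
... | tri< _ _ _ = D
... | tri≈ _ _ _ = F
... | tri> _ _ _ = U

data Shape {n} (i v : Fin n) : Letter → Set where
  up : toℕ i < toℕ v → Shape i v U
  down : toℕ v < toℕ i → Shape i v D
  fixed : v ≡ i → Shape i v F

shape : ∀ {n} (i v : Fin n) → Shape i v (letterOf i v)
shape i v with <-cmp (toℕ v) (toℕ i)
... | tri< lt _ _ = down lt
... | tri≈ _ eq _ = fixed (toℕ-injective eq)
... | tri> _ _ gt = up gt

shape-unique : ∀ {n} {i v : Fin n} {L L′} → Shape i v L → Shape i v L′ → L ≡ L′
shape-unique (up _) (up _) = refl
shape-unique (down _) (down _) = refl
shape-unique (fixed _) (fixed _) = refl
shape-unique (up lt) (down gt) = contradiction lt (<-asym gt)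
shape-unique (down gt) (up lt) = contradiction lt (<-asym gt)
shape-unique (up lt) (fixed refl) = contradiction lt (<-irrefl refl)
shape-unique (fixed refl) (up lt) = contradiction lt (<-irrefl refl)
shape-unique (down gt) (fixed refl) = contradiction gt (<-irrefl refl)
shape-unique (fixed refl) (down gt) = contradiction gt (<-irrefl refl)

letterOf-shape : ∀ {n} {i v : Fin n} {L} → Shape i v L → letterOf i v ≡ L
letterOf-shape {i = i} {v} = shape-unique (shape i v)

shape-of : ∀ {n} {i v : Fin n} {L} → letterOf i v ≡ L → Shape i v L
shape-of {i = i} {v} e = subst (Shape i v) e (shape i v)

encode : ∀ {n} → Vec (Fin n) n → Vec Letter n
encode π = tabulate (λ i → letterOf i (lookup π i))

encode-at : ∀ {n} (π : Vec (Fin n) n) i → lookup (encode π) i ≡ letterOf i (lookup π i)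
encode-at π i = lookup∘tabulate (λ i → letterOf i (lookup π i)) i

choose : ∀ {n} {P : Fin n → Set} → (∀ j → Dec (P j)) → Fin n → Fin n
choose P? d with any? P?
... | yes (j , _) = j
... | no _ = d

choose-spec : ∀ {n} {P : Fin n → Set} (P? : ∀ j → Dec (P j)) d → ∃ P → P (choose P? d)
choose-spec P? d ex with any? P?
... | yes (j , p) = p
... | no ¬ex = contradiction ex ¬ex

OfRank : ∀ {n} → Vec Letter n → Letter → ℕ → Fin n → Set
OfRank w L r j = lookup w j ≡ L × rank L w j ≡ r

ofRank? : ∀ {n} (w : Vec Letter n) L r j → Dec (OfRank w L r j)
ofRank? w L r j = (lookup w j ≟L L) ×-dec (rank L w j ≟ r)

partner : ∀ {n} → Vec Letter n → Fin n → Letter → Fin n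
partner w i F = i
partner w i U = choose (ofRank? w D (rank U w i)) i
partner w i D = choose (ofRank? w U (rank D w i)) i

decode : ∀ {n} → Vec Letter n → Vec (Fin n) n
decode w = tabulate (λ i → partner w i (lookup w i))

module Decode {n} (w : Vec Letter n) (p : Path 0 w) where
  π : Fin n → Fin n
  π = lookup (decode w)

  π-partner : ∀ {i L} → lookup w i ≡ L → π i ≡ partner w i L
  π-partner {i} e = trans (lookup∘tabulate (λ i → partner w i (lookup w i)) i) (cong (partner w i) e)

  ups=downs : total U w ≡ total D w
  ups=downs = sym (path-balance 0 w p)

  at-up : ∀ {i} → lookup w i ≡ U → OfRank w D (rank U w i) (π i)
  at-up {i} e = subst (OfRank w D (rank U w i)) (sym (π-partner e))
    (choose-spec (ofRank? w D (rank U w i)) i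
      (rank-attained D w (rank U w i) (subst (rank U w i <_) ups=downs (rank<total U w i e))))

  at-down : ∀ {i} → lookup w i ≡ D → OfRank w U (rank D w i) (π i)
  at-down {i} e = subst (OfRank w U (rank D w i)) (sym (π-partner e))
    (choose-spec (ofRank? w U (rank D w i)) i
      (rank-attained U w (rank D w i) (subst (rank D w i <_) (sym ups=downs) (rank<total D w i e))))

  at-flat : ∀ {i} → lookup w i ≡ F → π i ≡ i
  at-flat = π-partner

  up-forward : ∀ {i} → lookup w i ≡ U → toℕ i < toℕ (π i)
  up-forward {i} e with at-up e | <-cmp (toℕ i) (toℕ (π i))
  ... | _ | tri< lt _ _ = lt
  ... | isD , _ | tri≈ _ eq _ = contradiction (trans (sym e) (trans (cong (lookup w) (toℕ-injective eq)) isD)) λ ()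
  ... | isD , r | tri> _ _ gt = contradiction (rank-strict D w isD gt)
                                  (≤⇒≯ (subst (rank D w i ≤_) (sym r) (downs≤ups w p i)))

  down-backward : ∀ {i} → lookup w i ≡ D → toℕ (π i) < toℕ i
  down-backward {i} e with at-down e | <-cmp (toℕ i) (toℕ (π i))
  ... | _ , r | tri< lt _ _ = contradiction (downs<ups w p i e)
                                (≤⇒≯ (subst (rank U w i ≤_) r (rank-mono U w (<⇒≤ lt))))
  ... | isU , _ | tri≈ _ eq _ = contradiction (trans (sym e) (trans (cong (lookup w) (toℕ-injective eq)) isU)) λ ()
  ... | _ | tri> _ _ gt = gt

  involution : ∀ i → π (π i) ≡ i
  involution i with lookup w i in e
  ... | F = trans (cong π (at-flat e)) (at-flat e)
  ... | U = let isD , r = at-up e ; isU , r′ = at-down isD in rank-injective U w isU e (trans r′ r)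
  ... | D = let isU , r = at-down e ; isD , r′ = at-up isU in rank-injective D w isD e (trans r′ r)

  up-if-exceeds : ∀ a → toℕ a < toℕ (π a) → lookup w a ≡ U
  up-if-exceeds a lt with lookup w a in e
  ... | F = contradiction (cong toℕ (sym (at-flat e))) (<⇒≢ lt)
  ... | U = refl
  ... | D = contradiction lt (<-asym (down-backward e))

  down-if-below : ∀ a → toℕ (π a) < toℕ a → lookup w a ≡ D
  down-if-below a lt with lookup w a in e
  ... | F = contradiction (cong toℕ (at-flat e)) (<⇒≢ lt)
  ... | U = contradiction lt (<-asym (up-forward e))
  ... | D = refl

  -- A 321 pattern would pair two steps in a nested way, against the rank matching.
  avoids321 : Avoids321 (decode w)
  avoids321 i j k i<j j<k (πj<πi , πk<πj) with lookup w j in e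
  ... | F =
    let j<πi = subst (_< toℕ (π i)) (cong toℕ (at-flat e)) πj<πi
        iU = up-if-exceeds i (<-trans i<j j<πi)
    in contradiction (rank-strict U w iU i<j)
         (≤⇒≯ (subst (rank U w j ≤_) (proj₂ (at-up iU))
           (subst (_≤ rank D w (π i)) (downs≡ups w p j e) (rank-mono D w (<⇒≤ j<πi)))))
  ... | U =
    let iU = up-if-exceeds i (<-trans i<j (<-trans (up-forward e) πj<πi))
    in contradiction (rank-strict U w iU i<j)
         (<-asym (subst₂ _<_ (proj₂ (at-up e)) (proj₂ (at-up iU)) (rank-strict D w (proj₁ (at-up e)) πj<πi)))
  ... | D =
    let kD = down-if-below k (<-trans πk<πj (<-trans (down-backward e) j<k))
    in contradiction (rank-strict D w e j<k)
         (<-asym (subst₂ _<_ (proj₂ (at-down kD)) (proj₂ (at-down e)) (rank-strict U w (proj₁ (at-down kD)) πk<πj)))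

  decode-I321 : IsI321 (decode w)
  decode-I321 = ( (λ a b eq → trans (sym (involution a)) (trans (cong π eq) (involution b)))
                , (λ j → π j , involution j) )
              , involution , avoids321

  encode-decode : encode (decode w) ≡ w
  encode-decode = trans (tabulate-cong letter) (tabulate∘lookup w)
    where
    letter : ∀ i → letterOf i (π i) ≡ lookup w i
    letter i with lookup w i in e
    ... | F = letterOf-shape (fixed (at-flat e))
    ... | U = letterOf-shape (up (up-forward e))
    ... | D = letterOf-shape (down (down-backward e))

up-of : ∀ {n} {i v : Fin n} → letterOf i v ≡ U → toℕ i < toℕ v
up-of e with shape-of e
... | up lt = lt

down-of : ∀ {n} {i v : Fin n} → letterOf i v ≡ D → toℕ v < toℕ i
down-of e with shape-of e
... | down lt = lt

fixed-of : ∀ {n} {i v : Fin n} → letterOf i v ≡ F → v ≡ i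
fixed-of e with shape-of e
... | fixed eq = eq

SameLetters : ∀ {n} → Vec (Fin n) n → Vec (Fin n) n → Set
SameLetters π σ = ∀ i → letterOf i (lookup π i) ≡ letterOf i (lookup σ i)

AgreeBelow : ∀ {n} → Vec (Fin n) n → Vec (Fin n) n → Fin n → Set
AgreeBelow π σ i = ∀ k → toℕ k < toℕ i → lookup π k ≡ lookup σ k

-- Let π, σ be involutions with the same letters that agree before the up
-- step i, with σ avoiding 321.  Then π(i) < σ(i) is impossible: a = π(i)
-- is a down step of σ too, and σ(a) can be neither before, at, nor after i
-- (the last case gives the pattern σ(i) > σ(σ a) > σ(a)).
no-earlier-partner : ∀ {n} (π σ : Vec (Fin n) n) → IsInvolution π → IsInvolution σ → Avoids321 σ →
                     SameLetters π σ → ∀ i → AgreeBelow π σ i →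
                     toℕ i < toℕ (lookup π i) → ¬ toℕ (lookup π i) < toℕ (lookup σ i)
no-earlier-partner π σ invπ invσ avσ same i below i<a a<σi = placement (<-cmp (toℕ σa) (toℕ i))
  where
  a = lookup π i
  σa = lookup σ a

  σa<a : toℕ σa < toℕ a
  σa<a = down-of (trans (sym (same a)) (letterOf-shape (down (subst (λ x → toℕ x < toℕ a) (sym (invπ i)) i<a))))

  placement : Tri (toℕ σa < toℕ i) (toℕ σa ≡ toℕ i) (toℕ i < toℕ σa) → ⊥
  placement (tri< σa<i _ _) =
    contradiction (cong toℕ (trans (sym (invπ σa)) (trans (cong (lookup π) (trans (below σa σa<i) (invσ a))) (invπ i))))
                  (<⇒≢ σa<i)
  placement (tri≈ _ σa≡i _) =
    contradiction (cong toℕ (trans (sym (invσ a)) (cong (lookup σ) (toℕ-injective σa≡i)))) (<⇒≢ a<σi)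
  placement (tri> _ _ i<σa) =
    avσ i σa a i<σa σa<a ( subst (λ x → toℕ x < toℕ (lookup σ i)) (sym (invσ a)) a<σi
                         , subst (λ x → toℕ σa < toℕ x) (sym (invσ a)) σa<a )

agree-at : ∀ {n} (π σ : Vec (Fin n) n) → IsI321 π → IsI321 σ → SameLetters π σ →
           ∀ i → AgreeBelow π σ i → lookup π i ≡ lookup σ i
agree-at π σ (_ , invπ , avπ) (_ , invσ , avσ) same i below with letterOf i (lookup π i) in e
... | F = trans (fixed-of e) (sym (fixed-of (trans (sym (same i)) e)))
... | D = trans (sym (invσ (lookup π i))) (cong (lookup σ) (trans (sym (below (lookup π i) (down-of e))) (invπ i)))
... | U with <-cmp (toℕ (lookup π i)) (toℕ (lookup σ i))
...   | tri< πi<σi _ _ = contradiction πi<σi (no-earlier-partner π σ invπ invσ avσ same i below (up-of e))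
...   | tri≈ _ eq _ = toℕ-injective eq
...   | tri> _ _ σi<πi = contradiction σi<πi
          (no-earlier-partner σ π invσ invπ avπ (λ j → sym (same j)) i (λ k lt → sym (below k lt))
                              (up-of (trans (sym (same i)) e)))

agree-below : ∀ {n} (π σ : Vec (Fin n) n) → IsI321 π → IsI321 σ → SameLetters π σ →
              ∀ b i → toℕ i < b → lookup π i ≡ lookup σ i
agree-below π σ Iπ Iσ same (suc b) i (s≤s i≤b) =
  agree-at π σ Iπ Iσ same i (λ k k<i → agree-below π σ Iπ Iσ same b k (≤-trans k<i i≤b))

encode-injective : ∀ {n} (π σ : Vec (Fin n) n) → IsI321 π → IsI321 σ → encode π ≡ encode σ → π ≡ σ
encode-injective {n} π σ Iπ Iσ eq = begin
  π                            ≡⟨ sym (tabulate∘lookup π) ⟩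
  tabulate (lookup π)          ≡⟨ tabulate-cong (λ i → agree-below π σ Iπ Iσ same n i (toℕ<n i)) ⟩
  tabulate (lookup σ)          ≡⟨ tabulate∘lookup σ ⟩
  σ                            ∎
  where
  open ≡-Reasoning
  same : SameLetters π σ
  same i = trans (sym (encode-at π i)) (trans (cong (λ v → lookup v i) eq) (encode-at σ i))

countWhere : ∀ {n} {P : Fin n → Set} → (∀ u → Dec (P u)) → ℕ
countWhere {zero} P? = 0
countWhere {suc n} P? = (if does (P? fz) then 1 else 0) + countWhere (λ u → P? (fs u))

countWhere-none : ∀ {n} {P : Fin n → Set} (P? : ∀ u → Dec (P u)) → (∀ u → ¬ P u) → countWhere P? ≡ 0
countWhere-none {zero} P? none = refl
countWhere-none {suc n} P? none with P? fz
... | yes q = contradiction q (none fz)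
... | no _ = countWhere-none (λ u → P? (fs u)) (λ u → none (fs u))

countWhere-cong : ∀ {n} {P Q : Fin n → Set} (P? : ∀ u → Dec (P u)) (Q? : ∀ u → Dec (Q u)) →
                  (∀ u → P u → Q u) → (∀ u → Q u → P u) → countWhere P? ≡ countWhere Q?
countWhere-cong {zero} _ _ _ _ = refl
countWhere-cong {suc n} P? Q? pq qp with P? fz | Q? fz
... | yes _ | yes _ = cong suc (countWhere-cong (λ u → P? (fs u)) (λ u → Q? (fs u)) (λ u → pq (fs u)) (λ u → qp (fs u)))
... | no _ | no _ = countWhere-cong (λ u → P? (fs u)) (λ u → Q? (fs u)) (λ u → pq (fs u)) (λ u → qp (fs u))
... | yes p | no ¬q = contradiction (pq fz p) ¬q
... | no ¬p | yes q = contradiction (qp fz q) ¬p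

countWhere-extra : ∀ {n} {P Q : Fin n → Set} (P? : ∀ u → Dec (P u)) (Q? : ∀ u → Dec (Q u)) (a : Fin n) →
                   Q a → ¬ P a → (∀ u → u ≢ a → P u → Q u) → (∀ u → u ≢ a → Q u → P u) →
                   countWhere Q? ≡ suc (countWhere P?)
countWhere-extra {suc n} P? Q? fz qa ¬pa pq qp with P? fz | Q? fz
... | yes pa | _ = contradiction pa ¬pa
... | no _ | no ¬qa = contradiction qa ¬qa
... | no _ | yes _ = cong suc (countWhere-cong (λ u → Q? (fs u)) (λ u → P? (fs u))
                                 (λ u → qp (fs u) λ ()) (λ u → pq (fs u) λ ()))
countWhere-extra {suc n} P? Q? (fs a) qa ¬pa pq qp with P? fz | Q? fz
... | yes _ | yes _ = cong suc rest
  where rest = countWhere-extra (λ u → P? (fs u)) (λ u → Q? (fs u)) a qa ¬pa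
                 (λ u u≢a → pq (fs u) (u≢a ∘ suc-injective)) (λ u u≢a → qp (fs u) (u≢a ∘ suc-injective))
... | no _ | no _ = countWhere-extra (λ u → P? (fs u)) (λ u → Q? (fs u)) a qa ¬pa
                      (λ u u≢a → pq (fs u) (u≢a ∘ suc-injective)) (λ u u≢a → qp (fs u) (u≢a ∘ suc-injective))
... | yes p | no ¬q = contradiction (pq fz (λ ()) p) ¬q
... | no ¬p | yes q = contradiction (qp fz (λ ()) q) ¬p

record HeightProfile {n} (w : Vec Letter n) (H : ℕ → ℕ) : Set where
  field
    flat : ∀ i → lookup w i ≡ F → H (toℕ i) ≡ 0 × H (suc (toℕ i)) ≡ 0
    rise : ∀ i → lookup w i ≡ U → H (suc (toℕ i)) ≡ suc (H (toℕ i))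
    fall : ∀ i → lookup w i ≡ D → H (toℕ i) ≡ suc (H (suc (toℕ i)))
    ends : H n ≡ 0

tail-profile : ∀ {n x} {w : Vec Letter n} {H : ℕ → ℕ} → HeightProfile (x ∷ w) H → HeightProfile w (H ∘ suc)
tail-profile prof = record { flat = flat ∘ fs ; rise = rise ∘ fs ; fall = fall ∘ fs ; ends = ends }
  where open HeightProfile prof

path-from-profile : ∀ {n} (w : Vec Letter n) (H : ℕ → ℕ) → HeightProfile w H → Path (H 0) w
path-from-profile [] H prof = HeightProfile.ends prof
path-from-profile (F ∷ w) H prof =
  proj₁ (flat fz refl) , subst (λ h → Path h w) (proj₂ (flat fz refl)) (path-from-profile w (H ∘ suc) (tail-profile prof))
  where open HeightProfile prof
path-from-profile (U ∷ w) H prof =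
  subst (λ h → Path h w) (rise fz refl) (path-from-profile w (H ∘ suc) (tail-profile prof))
  where open HeightProfile prof
path-from-profile (D ∷ w) H prof =
  subst (λ h → Path h (D ∷ w)) (sym (fall fz refl)) (path-from-profile w (H ∘ suc) (tail-profile prof))
  where open HeightProfile prof

-- The encoding of a 321-avoiding involution π is a path from 0: the height
-- before position t is the number of arcs u ↦ π(u) with u < t ≤ π(u).
module EncodePath {n} (π : Vec (Fin n) n) (Iπ : IsI321 π) where
  private
    p : Fin n → Fin n
    p = lookup π

    inv : IsInvolution π
    inv = proj₁ (proj₂ Iπ)

    avoids : Avoids321 π
    avoids = proj₂ (proj₂ Iπ)

  Covers : ℕ → Fin n → Set
  Covers t u = toℕ u < t × t ≤ toℕ (p u)

  covers? : ∀ t u → Dec (Covers t u)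
  covers? t u = (toℕ u <? t) ×-dec (t ≤? toℕ (p u))

  height : ℕ → ℕ
  height t = countWhere (covers? t)

  -- No arc spans a fixed point, since the two would form a 321 pattern.
  fixed-uncovered : ∀ {i} → p i ≡ i → ∀ u → ¬ Covers (toℕ i) u
  fixed-uncovered {i} fix u (u<i , i≤pu) with m≤n⇒m<n∨m≡n i≤pu
  ... | inj₁ i<pu = avoids u i (p u) u<i i<pu
                      ( subst (λ x → toℕ x < toℕ (p u)) (sym fix) i<pu
                      , subst₂ (λ x y → toℕ x < toℕ y) (sym (inv u)) (sym fix) u<i )
  ... | inj₂ i≡pu = contradiction (cong toℕ (trans (sym (inv u)) (trans (cong p (sym (toℕ-injective i≡pu))) fix)))
                                  (<⇒≢ u<i)

  ends-at : ∀ {i} u → toℕ i ≡ toℕ (p u) → u ≡ p i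
  ends-at u i≡pu = trans (sym (inv u)) (cong p (sym (toℕ-injective i≡pu)))

  flat-step : ∀ i → lookup (encode π) i ≡ F → height (toℕ i) ≡ 0 × height (suc (toℕ i)) ≡ 0
  flat-step i e = countWhere-none (covers? _) (fixed-uncovered fix) , countWhere-none (covers? _) after
    where
    fix : p i ≡ i
    fix = fixed-of (trans (sym (encode-at π i)) e)
    after : ∀ u → ¬ Covers (suc (toℕ i)) u
    after u (u<1+i , 1+i≤pu) with m≤n⇒m<n∨m≡n (s≤s⁻¹ u<1+i)
    ... | inj₁ u<i = fixed-uncovered fix u (u<i , <⇒≤ 1+i≤pu)
    ... | inj₂ u≡i = <-irrefl (cong toℕ (sym fix)) (subst (λ x → toℕ i < toℕ (p x)) (toℕ-injective u≡i) 1+i≤pu)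

  rise-step : ∀ i → lookup (encode π) i ≡ U → height (suc (toℕ i)) ≡ suc (height (toℕ i))
  rise-step i e = countWhere-extra (covers? (toℕ i)) (covers? (suc (toℕ i))) i
                    (n<1+n _ , i<pi) (λ c → <-irrefl refl (proj₁ c)) kept lost
    where
    i<pi : toℕ i < toℕ (p i)
    i<pi = up-of (trans (sym (encode-at π i)) e)
    kept : ∀ u → u ≢ i → Covers (toℕ i) u → Covers (suc (toℕ i)) u
    kept u _ (u<i , i≤pu) = m<n⇒m<1+n u<i , ≤∧≢⇒< i≤pu λ i≡pu →
      <-asym u<i (subst (λ x → toℕ i < toℕ x) (sym (ends-at u i≡pu)) i<pi)
    lost : ∀ u → u ≢ i → Covers (suc (toℕ i)) u → Covers (toℕ i) u
    lost u u≢i (u<1+i , 1+i≤pu) = ≤∧≢⇒< (s≤s⁻¹ u<1+i) (u≢i ∘ toℕ-injective) , <⇒≤ 1+i≤pu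

  fall-step : ∀ i → lookup (encode π) i ≡ D → height (toℕ i) ≡ suc (height (suc (toℕ i)))
  fall-step i e = countWhere-extra (covers? (suc (toℕ i))) (covers? (toℕ i)) (p i)
                    (pi<i , ≤-reflexive (cong toℕ (sym (inv i)))) (λ c → <-irrefl (cong toℕ (sym (inv i))) (proj₂ c))
                    kept lost
    where
    pi<i : toℕ (p i) < toℕ i
    pi<i = down-of (trans (sym (encode-at π i)) e)
    kept : ∀ u → u ≢ p i → Covers (suc (toℕ i)) u → Covers (toℕ i) u
    kept u _ (u<1+i , 1+i≤pu) = ≤∧≢⇒< (s≤s⁻¹ u<1+i) u≢i , <⇒≤ 1+i≤pu
      where
      u≢i : toℕ u ≢ toℕ i
      u≢i u≡i = <-asym pi<i (subst (λ x → toℕ i < toℕ (p x)) (toℕ-injective u≡i) 1+i≤pu)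
    lost : ∀ u → u ≢ p i → Covers (toℕ i) u → Covers (suc (toℕ i)) u
    lost u u≢pi (u<i , i≤pu) = m<n⇒m<1+n u<i , ≤∧≢⇒< i≤pu (u≢pi ∘ ends-at u)

  profile : HeightProfile (encode π) height
  profile = record
    { flat = flat-step ; rise = rise-step ; fall = fall-step
    ; ends = countWhere-none (covers? n) (λ u c → <⇒≱ (toℕ<n (p u)) (proj₂ c)) }

  encode-path : Path 0 (encode π)
  encode-path = subst (λ h → Path h (encode π))
                      (countWhere-none (covers? 0) (λ u ()))
                      (path-from-profile (encode π) height profile)

unique-same-length : ∀ {A : Set} {xs ys : List A} → Unique xs → Unique ys →
                     (∀ {x} → x ∈ xs ⇔ x ∈ ys) → length xs ≡ length ys
unique-same-length uxs uys same = ↭-length (∼bag⇒↭ (unique∧set⇒bag uxs uys same))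

unique-map-on : ∀ {A B : Set} (f : A → B) {xs : List A} →
                (∀ {x y} → x ∈ xs → y ∈ xs → f x ≡ f y → x ≡ y) → Unique xs → Unique (map f xs)
unique-map-on f inj AP.[] = AP.[]
unique-map-on f inj (x∉xs AP.∷ u) =
  AllP.map⁺ (All.tabulate (λ y∈ fx≡fy → All.lookup x∉xs y∈ (inj (here refl) (there y∈) fx≡fy)))
  AP.∷ unique-map-on f (λ x∈ y∈ → inj (there x∈) (there y∈)) u

cons-disjoint : ∀ {A : Set} {n} {a b : A} (xs ys : List (Vec A n)) → a ≢ b → Disjoint (map (a ∷_) xs) (map (b ∷_) ys)
cons-disjoint {a = a} {b} xs ys a≢b (m₁ , m₂) with ∈-map⁻ (a ∷_) m₁ | ∈-map⁻ (b ∷_) m₂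
... | _ , _ , refl | _ , _ , eq = a≢b (∷-injectiveˡ eq)

paths-sound : ∀ h n {w : Vec Letter n} → w ∈ paths h n → Path h w
paths-sound zero zero (here refl) = refl
paths-sound zero (suc n) m with ∈-++⁻ (map (F ∷_) (paths 0 n)) m
... | inj₁ m₁ with ∈-map⁻ (F ∷_) m₁
...   | _ , m′ , refl = refl , paths-sound 0 n m′
paths-sound zero (suc n) m | inj₂ m₂ with ∈-map⁻ (U ∷_) m₂
...   | _ , m′ , refl = paths-sound 1 n m′
paths-sound (suc h) (suc n) m with ∈-++⁻ (map (U ∷_) (paths (suc (suc h)) n)) m
... | inj₁ m₁ with ∈-map⁻ (U ∷_) m₁
...   | _ , m′ , refl = paths-sound (suc (suc h)) n m′
paths-sound (suc h) (suc n) m | inj₂ m₂ with ∈-map⁻ (D ∷_) m₂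
...   | _ , m′ , refl = paths-sound h n m′

paths-complete : ∀ h n (w : Vec Letter n) → Path h w → w ∈ paths h n
paths-complete zero zero [] _ = here refl
paths-complete zero (suc n) (F ∷ w) (_ , p) = ∈-++⁺ˡ (∈-map⁺ (F ∷_) (paths-complete 0 n w p))
paths-complete zero (suc n) (U ∷ w) p = ∈-++⁺ʳ (map (F ∷_) (paths 0 n)) (∈-map⁺ (U ∷_) (paths-complete 1 n w p))
paths-complete (suc h) (suc n) (U ∷ w) p = ∈-++⁺ˡ (∈-map⁺ (U ∷_) (paths-complete (suc (suc h)) n w p))
paths-complete (suc h) (suc n) (D ∷ w) p =
  ∈-++⁺ʳ (map (U ∷_) (paths (suc (suc h)) n)) (∈-map⁺ (D ∷_) (paths-complete h n w p))

paths-unique : ∀ h n → Unique (paths h n)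
paths-unique zero zero = All.[] AP.∷ AP.[]
paths-unique (suc h) zero = AP.[]
paths-unique zero (suc n) =
  UP.++⁺ (UP.map⁺ ∷-injectiveʳ (paths-unique 0 n)) (UP.map⁺ ∷-injectiveʳ (paths-unique 1 n))
         (cons-disjoint (paths 0 n) (paths 1 n) λ ())
paths-unique (suc h) (suc n) =
  UP.++⁺ (UP.map⁺ ∷-injectiveʳ (paths-unique (suc (suc h)) n)) (UP.map⁺ ∷-injectiveʳ (paths-unique h n))
         (cons-disjoint (paths (suc (suc h)) n) (paths h n) λ ())

allVecs-complete : ∀ n k (v : Vec (Fin n) k) → v ∈ allVecs n k
allVecs-complete n zero [] = here refl
allVecs-complete n (suc k) (a ∷ v) =
  ∈-concatMap⁺ (λ a → map (a ∷_) (allVecs n k))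
    (Any.map (λ { refl → ∈-map⁺ (a ∷_) (allVecs-complete n k v) }) (∈-allFin a))

allVecs-unique : ∀ n k → Unique (allVecs n k)
allVecs-unique n zero = All.[] AP.∷ AP.[]
allVecs-unique n (suc k) =
  UP.concat⁺ (AllP.map⁺ (All.universal (λ a → UP.map⁺ ∷-injectiveʳ (allVecs-unique n k)) (allFin n)))
             (APP.map⁺ (AP.map (λ a≢b {v} → cons-disjoint (allVecs n k) (allVecs n k) a≢b {v}) (UP.allFin⁺ n)))

I321count≡pathCount : ∀ n → I321count n ≡ pathCount 0 n
I321count≡pathCount n = begin
  I321count n                          ≡⟨ unique-same-length (UP.filter⁺ isI321? (allVecs-unique n n)) decoded-unique (mk⇔ to from) ⟩
  length (map decode (paths 0 n))      ≡⟨ length-map decode (paths 0 n) ⟩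
  pathCount 0 n                        ∎
  where
  open ≡-Reasoning
  involutions = filter isI321? (allVecs n n)

  decoded-unique : Unique (map decode (paths 0 n))
  decoded-unique = unique-map-on decode
    (λ {v} {w} v∈ w∈ eq → begin
       v                       ≡⟨ sym (Decode.encode-decode v (paths-sound 0 n v∈)) ⟩
       encode (decode v)       ≡⟨ cong encode eq ⟩
       encode (decode w)       ≡⟨ Decode.encode-decode w (paths-sound 0 n w∈) ⟩
       w                       ∎)
    (paths-unique 0 n)

  to : ∀ {π} → π ∈ involutions → π ∈ map decode (paths 0 n)
  to {π} m = subst (_∈ map decode (paths 0 n)) decode-encode
                   (∈-map⁺ decode (paths-complete 0 n (encode π) path))
    where
    Iπ = proj₂ (∈-filter⁻ isI321? {xs = allVecs n n} m)
    path = EncodePath.encode-path π Iπ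
    decode-encode : decode (encode π) ≡ π
    decode-encode = encode-injective (decode (encode π)) π (Decode.decode-I321 (encode π) path) Iπ
                                     (Decode.encode-decode (encode π) path)

  from : ∀ {π} → π ∈ map decode (paths 0 n) → π ∈ involutions
  from m with ∈-map⁻ decode m
  ... | w , w∈ , refl = ∈-filter⁺ isI321? (allVecs-complete n n _) (Decode.decode-I321 w (paths-sound 0 n w∈))

%2-suc-suc : ∀ n → suc (suc n) % 2 ≡ n % 2
%2-suc-suc n = trans (cong (_% 2) (+-comm 2 n)) ([m+n]%n≡m%n n 2)

parity-cases : ∀ n → (Even n × n % 2 ≡ 0 × suc n % 2 ≡ 1) ⊎ (Odd n × n % 2 ≡ 1 × suc n % 2 ≡ 0)
parity-cases zero = inj₁ (even-zero , refl , refl)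
parity-cases (suc n) with parity-cases n
... | inj₁ (e , q , r) = inj₂ (odd-suc e , r , trans (%2-suc-suc n) q)
... | inj₂ (o , q , r) = inj₁ (even-suc o , r , trans (%2-suc-suc n) q)

I321count-double : ∀ n → Odd n → I321count (suc n) ≡ 2 * I321count n
I321count-double n o = begin
  I321count (suc n)     ≡⟨ I321count≡pathCount (suc n) ⟩
  pathCount 0 (suc n)   ≡⟨ pathCount-double n o ⟩
  2 * pathCount 0 n     ≡⟨ cong (2 *_) (sym (I321count≡pathCount n)) ⟩
  2 * I321count n       ∎
  where open ≡-Reasoning

theorem3p6 : (∀ n → (εSeries ⊕ ωSeries) n ≡ fSeries n)
    × (∀ n → εSeries n ≡ (2 ·ₛ (x· ωSeries)) n)
theorem3p6 = even+odd , even≡2x·odd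
  where
  even+odd : ∀ n → (εSeries ⊕ ωSeries) n ≡ fSeries n
  even+odd zero = refl
  even+odd (suc n) with parity-cases n
  ... | inj₁ (_ , _ , odd-next) rewrite odd-next = refl
  ... | inj₂ (_ , _ , even-next) rewrite even-next = +-identityʳ (I321count (suc n))

  even≡2x·odd : ∀ n → εSeries n ≡ (2 ·ₛ (x· ωSeries)) n
  even≡2x·odd zero = refl
  even≡2x·odd (suc n) with parity-cases n
  ... | inj₁ (_ , even-n , odd-next) rewrite even-n | odd-next = refl
  ... | inj₂ (odd , odd-n , even-next) rewrite odd-n | even-next = I321count-double n odd
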